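{- Let $w$ be an infinite word (beginning with $0$) generated by a primitive morphism $\phi$ on $\Sigma=\{0,\dots,\sigma-1\}$, and suppose that for every letter $a$ the word $\phi(a)$ contains every letter of $\Sigma$. For each letter $a$ write $\phi(a)=x_a0v_{a,0}0v_{a,1}0\cdots0v_{a,k_a-1}0y_a$ with $v_{a,i},x_a,y_a\in(\Sigma\setminus\{0\})^*$. Then every return to $0$ in $w$ is either of the form $0v_{a,i}$ for some letter $a$ and index $i$, or of the form $0y_ax_b$ for some letters $a,b$ such that $ab$ is a factor of $w$ (i.e. $ab$ is an edge of the graph of $w$).
   Context: A morphism is nonerasing; $w$ is generated by $\phi$ if $\phi(0)=0s$ with $s$ nonempty and $w=\lim_n\phi^n(0)$. $\phi$ is primitive if for each letter $x$ some $\phi^k(x)$ contains every letter. If $a_0<a_1<\dots$ are the positions of $0$ in $w$, the returns to $0$ are the factors $w[a_i,a_{i+1})$. The graph of $w$ is the directed graph on vertex set $\Sigma$ with an edge from $a$ to $b$ iff $ab$ is a factor of $w$. -}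

module Defs where

open import Data.Nat using (ℕ; zero; suc; _+_; _∸_; _<_)
open import Data.Fin using (Fin)
open import Data.List using (List; []; _∷_; _++_; [_]; map; concatMap; upTo; length; lookup)
open import Data.List.Membership.Propositional using (_∈_)
open import Data.Product using (Σ; ∃; _×_)
open import Relation.Binary.PropositionalEquality using (_≡_; _≢_)

-- Alphabet Σ = {0,…,n} represented by Fin (suc n); the letter 0 is Fin.zero.
Letter : ℕ → Set
Letter n = Fin (suc n)

Word : ℕ → Set
Word n = List (Letter n)

InfWord : ℕ → Set
InfWord n = ℕ → Letter n

Morphism : ℕ → Set
Morphism n = Letter n → Word n

ext : ∀ {n} → Morphism n → Word n → Word n
ext φ u = concatMap φ u

iter : ∀ {n} → Morphism n → ℕ → Word n → Word n
iter φ zero    u = u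
iter φ (suc k) u = ext φ (iter φ k u)

NonErasing : ∀ {n} → Morphism n → Set
NonErasing φ = ∀ a → φ a ≢ []

Prolongable : ∀ {n} → Morphism n → Set
Prolongable φ = Σ _ λ s → (φ Fin.zero ≡ Fin.zero ∷ s) × (s ≢ [])

Primitive : ∀ {n} → Morphism n → Set
Primitive {n} φ = ∀ (x : Letter n) → ∃ λ k → ∀ (y : Letter n) → y ∈ iter φ k [ x ]

-- the factor w[i, j) (empty if j ≤ i)
slice : ∀ {n} → InfWord n → ℕ → ℕ → Word n
slice w i j = map (λ k → w (i + k)) (upTo (j ∸ i))

IsPrefix : ∀ {n} → Word n → InfWord n → Set
IsPrefix u w = slice w 0 (length u) ≡ u

-- w = lim φ^k(0): every φ^k(0) is a prefix of w
GeneratedBy : ∀ {n} → Morphism n → InfWord n → Set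
GeneratedBy φ w = NonErasing φ × Prolongable φ
                  × (∀ k → IsPrefix (iter φ k [ Fin.zero ]) w)

IsReturnAt : ∀ {n} → InfWord n → ℕ → ℕ → Set
IsReturnAt w i j = i < j × w i ≡ Fin.zero × w j ≡ Fin.zero
                   × (∀ l → i < l → l < j → w l ≢ Fin.zero)

Edge : ∀ {n} → InfWord n → Letter n → Letter n → Set
Edge w a b = ∃ λ i → w i ≡ a × w (suc i) ≡ b

ZeroFree : ∀ {n} → Word n → Set
ZeroFree u = ∀ {c} → c ∈ u → c ≢ Fin.zero

assemble : ∀ {n} → Word n → List (Word n) → Word n → Word n
assemble x vs y = x ++ (Fin.zero ∷ concatMap (λ v → v ++ [ Fin.zero ]) vs) ++ y

Decomposition : ∀ {n} → Morphism n → (Letter n → Word n) → (Letter n → List (Word n))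
                → (Letter n → Word n) → Set
Decomposition φ x v y = ∀ a → φ a ≡ assemble (x a) (v a) (y a)
                              × ZeroFree (x a) × ZeroFree (y a)
                              × (∀ {u} → u ∈ v a → ZeroFree u)

{-# OPTIONS --safe #-}
-- Let u = φʲ(0). Then φ(u) is a prefix of w longer than j, so the return w[i, j) is
-- 0r for a factor 0r0 of φ(u) with r free of 0. Writing u = a₀a₁⋯aₘ, the word φ(u)
-- equals x_{a₀} 0 B₁ 0 B₂ 0 ⋯ 0 B_k 0 y_{aₘ}, where the 0-free blocks B are the v_{a_l,i}
-- and the junctions y_{a_l} x_{a_{l+1}}. As all the pieces are 0-free, the factors 0r0 of
-- this word are exactly the 0B_t0; and the letters a_l a_{l+1} of a junction are adjacent in
-- the prefix u of w, i.e. form an edge of the graph of w.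
module Submission where

open import Defs
open import Data.Nat using (ℕ; zero; suc; _+_; _≤_; _<_; z≤n; s≤s)
open import Data.Nat.Properties
  using (+-assoc; +-identityʳ; m+n∸m≡n; m+n∸n≡m; m≤n⇒∃[o]m+o≡n; n≤1+n; m≤n⇒m≤1+n; m≤m+n;
         +-monoʳ-<; +-mono-≤; <⇒≤; ≤-trans; module ≤-Reasoning)
open import Data.Fin using (Fin; zero)
open import Data.List using (List; []; _∷_; _++_; [_]; length; lookup; map; concatMap; upTo; applyUpTo)
open import Data.List.Properties using (++-assoc; ++-identityʳ; length-++; map-upTo; concatMap-++)
open import Data.List.Membership.Propositional using (_∈_)
open import Data.List.Membership.Propositional.Properties using (∈-++⁻)
open import Data.List.Relation.Unary.Any using (here; there; index)
open import Data.List.Relation.Unary.Any.Properties using (lookup-index)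
open import Data.List.Relation.Unary.All as All using (All)
open import Data.List.Relation.Unary.All.Properties using (applyUpTo⁺₁)
open import Data.List.Relation.Binary.Pointwise using (≡⇒Pointwise-≡)
open import Data.List.Relation.Binary.Prefix.Heterogeneous using (Prefix; []; _∷_)
open import Data.List.Relation.Binary.Infix.Heterogeneous using (Infix; here; there; _++ⁱ_; _ⁱ++_)
open import Data.List.Relation.Binary.Infix.Heterogeneous.Properties using (fromPointwise)
open import Data.Product using (Σ; ∃; ∃₂; _×_; _,_; proj₁; proj₂)
open import Data.Sum as Sum using (_⊎_; inj₁; inj₂)
open import Data.Empty using (⊥-elim)
open import Function using (_∘_)
open import Relation.Nullary using (¬_)
open import Relation.Binary.PropositionalEquality
  using (_≡_; _≢_; refl; sym; trans; cong; cong₂; subst; subst₂; module ≡-Reasoning)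

module _ {a} {A : Set a} where

  applyUpTo-cong : ∀ {f g : ℕ → A} → (∀ k → f k ≡ g k) → ∀ n → applyUpTo f n ≡ applyUpTo g n
  applyUpTo-cong f≗g zero    = refl
  applyUpTo-cong f≗g (suc n) = cong₂ _∷_ (f≗g 0) (applyUpTo-cong (f≗g ∘ suc) n)

  applyUpTo-+ : ∀ (f : ℕ → A) m n → applyUpTo f (m + n) ≡ applyUpTo f m ++ applyUpTo (λ k → f (m + k)) n
  applyUpTo-+ f zero    n = refl
  applyUpTo-+ f (suc m) n = cong (f 0 ∷_) (applyUpTo-+ (f ∘ suc) m n)

  Infix-applyUpTo⁻ : ∀ (f : ℕ → A) n {b c} → Infix _≡_ (b ∷ c ∷ []) (applyUpTo f n) →
                     ∃ λ m → f m ≡ b × f (suc m) ≡ c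
  Infix-applyUpTo⁻ f zero          (here ())
  Infix-applyUpTo⁻ f (suc zero)    (here (_ ∷ ()))
  Infix-applyUpTo⁻ f (suc (suc n)) (here (refl ∷ refl ∷ [])) = 0 , refl , refl
  Infix-applyUpTo⁻ f (suc n)       (there inf) with m , fm≡b , fsm≡c ← Infix-applyUpTo⁻ (f ∘ suc) n inf
    = suc m , fm≡b , fsm≡c


module _ {n} (w : InfWord n) where

  slice-+ : ∀ i m → slice w i (i + m) ≡ applyUpTo (λ k → w (i + k)) m
  slice-+ i m = trans (cong (map (λ k → w (i + k)) ∘ upTo) (m+n∸m≡n i m)) (map-upTo _ m)

  slice-single : ∀ i → slice w i (suc i) ≡ [ w i ]
  slice-single i = trans (cong (map (λ k → w (i + k)) ∘ upTo) (m+n∸n≡m 1 i))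
                         (cong (λ l → [ w l ]) (+-identityʳ i))

  slice-++ : ∀ {i j k} → i ≤ j → j ≤ k → slice w i k ≡ slice w i j ++ slice w j k
  slice-++ {i} i≤j j≤k with m , refl ← m≤n⇒∃[o]m+o≡n i≤j | l , refl ← m≤n⇒∃[o]m+o≡n j≤k = begin
    slice w i (i + m + l)
      ≡⟨ cong (slice w i) (+-assoc i m l) ⟩
    slice w i (i + (m + l))
      ≡⟨ slice-+ i (m + l) ⟩
    applyUpTo (λ k → w (i + k)) (m + l)
      ≡⟨ applyUpTo-+ _ m l ⟩
    applyUpTo (λ k → w (i + k)) m ++ applyUpTo (λ k → w (i + (m + k))) l
      ≡⟨ cong₂ _++_ (slice-+ i m) (applyUpTo-cong (λ k → cong w (+-assoc i m k)) l) ⟨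
    slice w i (i + m) ++ applyUpTo (λ k → w (i + m + k)) l
      ≡⟨ cong (slice w i (i + m) ++_) (slice-+ (i + m) l) ⟨
    slice w i (i + m) ++ slice w (i + m) (i + m + l)
      ∎
    where open ≡-Reasoning

  slice-∷ : ∀ {i j} → i < j → slice w i j ≡ w i ∷ slice w (suc i) j
  slice-∷ {i} {j} i<j = trans (slice-++ (n≤1+n i) i<j) (cong (_++ slice w (suc i) j) (slice-single i))

  slice-∷ʳ : ∀ {i j} → i ≤ j → slice w i (suc j) ≡ slice w i j ++ [ w j ]
  slice-∷ʳ {i} {j} i≤j = trans (slice-++ i≤j (n≤1+n j)) (cong (slice w i j ++_) (slice-single j))

  Infix-slice : ∀ {k i j l} → k ≤ i → i ≤ j → j ≤ l → Infix _≡_ (slice w i j) (slice w k l)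
  Infix-slice {k} {i} {j} {l} k≤i i≤j j≤l =
    subst (Infix _≡_ _) (sym split) (slice w k i ++ⁱ (fromPointwise (≡⇒Pointwise-≡ refl) ⁱ++ slice w j l))
    where
    split : slice w k l ≡ slice w k i ++ slice w i j ++ slice w j l
    split = trans (slice-++ k≤i (≤-trans i≤j j≤l)) (cong (slice w k i ++_) (slice-++ i≤j j≤l))

  All-slice-+ : ∀ {p} {P : Letter n → Set p} i m →
                (∀ {k} → k < m → P (w (i + k))) → All P (slice w i (i + m))
  All-slice-+ i m Pw = subst (All _) (sym (slice-+ i m)) (applyUpTo⁺₁ _ m Pw)

  IsPrefix⇒Edge : ∀ {u a b} → IsPrefix u w → Infix _≡_ (a ∷ b ∷ []) u → Edge w a b
  IsPrefix⇒Edge {u} prefix ab =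
    Infix-applyUpTo⁻ w (length u) (subst (Infix _≡_ _) (trans (sym prefix) (map-upTo w (length u))) ab)

  slice-return : ∀ {i j} → IsReturnAt w i j → slice w i (suc j) ≡ zero ∷ slice w (suc i) j ++ [ zero ]
  slice-return {i} {j} (i<j , wi , wj , _) = begin
    slice w i (suc j)                       ≡⟨ slice-∷ʳ (<⇒≤ i<j) ⟩
    slice w i j ++ [ w j ]                  ≡⟨ cong (_++ [ w j ]) (slice-∷ i<j) ⟩
    w i ∷ slice w (suc i) j ++ [ w j ]      ≡⟨ cong₂ (λ c d → c ∷ slice w (suc i) j ++ [ d ]) wi wj ⟩
    zero ∷ slice w (suc i) j ++ [ zero ]    ∎
    where open ≡-Reasoning

  zeroFree-return : ∀ {i j} → IsReturnAt w i j → ZeroFree (slice w (suc i) j)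
  zeroFree-return {i} (i<j , _ , _ , between) with m , refl ← m≤n⇒∃[o]m+o≡n i<j =
    All.lookup (All-slice-+ (suc i) m λ {k} k<m →
      between (suc i + k) (s≤s (m≤m+n i k)) (+-monoʳ-< (suc i) k<m))


module _ {n : ℕ} where

  zeroTerminated : List (Word n) → Word n
  zeroTerminated = concatMap (_++ [ zero ])

  zeroTerminated-∷ : ∀ V vs (Y : Word n) →
                     zeroTerminated (V ∷ vs) ++ Y ≡ V ++ zero ∷ zeroTerminated vs ++ Y
  zeroTerminated-∷ V vs Y = trans (++-assoc (V ++ [ zero ]) _ Y) (++-assoc V [ zero ] _)

  zeroFree-++ : ∀ {A B : Word n} → ZeroFree A → ZeroFree B → ZeroFree (A ++ B)
  zeroFree-++ {A} zA zB c∈ = Sum.[ zA , zB ] (∈-++⁻ A c∈)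

  zeroFree-¬Prefix : ∀ {Y : Word n} r {S} → ZeroFree Y → ¬ Prefix _≡_ (r ++ zero ∷ S) Y
  zeroFree-¬Prefix []      zY (p ∷ _)  = zY (here refl) (sym p)
  zeroFree-¬Prefix (_ ∷ r) zY (_ ∷ ps) = zeroFree-¬Prefix r (zY ∘ there) ps

  zeroFree-¬Infix : ∀ {Y : Word n} {S} → ZeroFree Y → ¬ Infix _≡_ (zero ∷ S) Y
  zeroFree-¬Infix zY (here p)    = zeroFree-¬Prefix [] zY p
  zeroFree-¬Infix zY (there inf) = zeroFree-¬Infix (zY ∘ there) inf

  Infix-zero-++⁻ : ∀ (X : Word n) {B S} → ZeroFree X →
                   Infix _≡_ (zero ∷ S) (X ++ B) → Infix _≡_ (zero ∷ S) B
  Infix-zero-++⁻ []      zX inf              = inf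
  Infix-zero-++⁻ (_ ∷ X) zX (here (p ∷ _))   = ⊥-elim (zX (here refl) (sym p))
  Infix-zero-++⁻ (_ ∷ X) zX (there inf)      = Infix-zero-++⁻ X (zX ∘ there) inf

  Prefix-zeroFree-injective : ∀ (r V : Word n) {S T} → ZeroFree r → ZeroFree V →
                              Prefix _≡_ (r ++ zero ∷ S) (V ++ zero ∷ T) → r ≡ V
  Prefix-zeroFree-injective []      []      zr zV _        = refl
  Prefix-zeroFree-injective []      (_ ∷ V) zr zV (p ∷ _)  = ⊥-elim (zV (here refl) (sym p))
  Prefix-zeroFree-injective (_ ∷ r) []      zr zV (p ∷ _)  = ⊥-elim (zr (here refl) p)
  Prefix-zeroFree-injective (_ ∷ r) (_ ∷ V) zr zV (p ∷ ps) =
    cong₂ _∷_ p (Prefix-zeroFree-injective r V (zr ∘ there) (zV ∘ there) ps)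

  Infix-zeroTerminated⁻ : ∀ vs {r Y : Word n} → ZeroFree r → (∀ {V} → V ∈ vs → ZeroFree V) → ZeroFree Y →
                          Infix _≡_ (zero ∷ r ++ [ zero ]) (zero ∷ zeroTerminated vs ++ Y) → r ∈ vs
  Infix-zeroTerminated⁻ [] zr zvs zY (here (_ ∷ p)) = ⊥-elim (zeroFree-¬Prefix _ zY p)
  Infix-zeroTerminated⁻ [] zr zvs zY (there inf)    = ⊥-elim (zeroFree-¬Infix zY inf)
  Infix-zeroTerminated⁻ (V ∷ vs) {r} {Y} zr zvs zY inf
    with subst (Infix _≡_ _) (cong (zero ∷_) (zeroTerminated-∷ V vs Y)) inf
  ... | here (_ ∷ p) = here (Prefix-zeroFree-injective r V zr (zvs (here refl)) p)
  ... | there inf′   =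
    there (Infix-zeroTerminated⁻ vs zr (zvs ∘ there) zY (Infix-zero-++⁻ V (zvs (here refl)) inf′))

  Infix-assemble⁻ : ∀ X vs {r Y : Word n} → ZeroFree X → (∀ {V} → V ∈ vs → ZeroFree V) → ZeroFree Y →
                    ZeroFree r → Infix _≡_ (zero ∷ r ++ [ zero ]) (assemble X vs Y) → r ∈ vs
  Infix-assemble⁻ X vs zX zvs zY zr inf = Infix-zeroTerminated⁻ vs zr zvs zY (Infix-zero-++⁻ X zX inf)

  assemble-++ : ∀ X vs Y X′ vs′ (Y′ : Word n) →
                assemble X vs Y ++ assemble X′ vs′ Y′ ≡ assemble X (vs ++ (Y ++ X′) ∷ vs′) Y′
  assemble-++ X vs Y X′ vs′ Y′ = trans (++-assoc X _ _) (cong (λ T → X ++ zero ∷ T) (begin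
    (zeroTerminated vs ++ Y) ++ X′ ++ zero ∷ zeroTerminated vs′ ++ Y′
      ≡⟨ ++-assoc (zeroTerminated vs) Y _ ⟩
    zeroTerminated vs ++ Y ++ X′ ++ zero ∷ zeroTerminated vs′ ++ Y′
      ≡⟨ cong (zeroTerminated vs ++_) (++-assoc Y X′ _) ⟨
    zeroTerminated vs ++ (Y ++ X′) ++ zero ∷ zeroTerminated vs′ ++ Y′
      ≡⟨ cong (zeroTerminated vs ++_) (zeroTerminated-∷ (Y ++ X′) vs′ Y′) ⟨
    zeroTerminated vs ++ zeroTerminated ((Y ++ X′) ∷ vs′) ++ Y′
      ≡⟨ ++-assoc (zeroTerminated vs) _ Y′ ⟨
    (zeroTerminated vs ++ zeroTerminated ((Y ++ X′) ∷ vs′)) ++ Y′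
      ≡⟨ cong (_++ Y′) (concatMap-++ _ vs _) ⟨
    zeroTerminated (vs ++ (Y ++ X′) ∷ vs′) ++ Y′
      ∎))
    where open ≡-Reasoning


module Blocks {n} (x : Letter n → Word n) (v : Letter n → List (Word n)) (y : Letter n → Word n) where

  blocks : Letter n → Word n → List (Word n)
  blocks a []      = v a
  blocks a (b ∷ u) = v a ++ (y a ++ x b) ∷ blocks b u

  lastLetter : Letter n → Word n → Letter n
  lastLetter a []      = a
  lastLetter a (b ∷ u) = lastLetter b u

  ∈-blocks⁻ : ∀ a u {r} → r ∈ blocks a u →
              (∃ λ c → r ∈ v c) ⊎ (∃₂ λ c d → Infix _≡_ (c ∷ d ∷ []) (a ∷ u) × r ≡ y c ++ x d)
  ∈-blocks⁻ a []      r∈ = inj₁ (a , r∈)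
  ∈-blocks⁻ a (b ∷ u) r∈ with ∈-++⁻ (v a) r∈
  ... | inj₁ r∈va         = inj₁ (a , r∈va)
  ... | inj₂ (here refl)  = inj₂ (a , b , here (refl ∷ refl ∷ []) , refl)
  ... | inj₂ (there r∈bu) = Sum.map₂ (λ (c , d , cd , r≡) → c , d , there cd , r≡) (∈-blocks⁻ b u r∈bu)

module _ {n} {φ : Morphism n} {x : Letter n → Word n} {v : Letter n → List (Word n)} {y : Letter n → Word n}
         (D : Decomposition φ x v y) where

  open Blocks x v y

  private
    φ-assemble : ∀ a → φ a ≡ assemble (x a) (v a) (y a)
    φ-assemble a = proj₁ (D a)

    zeroFree-x : ∀ a → ZeroFree (x a)
    zeroFree-x a = proj₁ (proj₂ (D a))

    zeroFree-y : ∀ a → ZeroFree (y a)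
    zeroFree-y a = proj₁ (proj₂ (proj₂ (D a)))

    zeroFree-v : ∀ a {V} → V ∈ v a → ZeroFree V
    zeroFree-v a = proj₂ (proj₂ (proj₂ (D a)))

  ext-assemble : ∀ a u → ext φ (a ∷ u) ≡ assemble (x a) (blocks a u) (y (lastLetter a u))
  ext-assemble a []      = trans (++-identityʳ (φ a)) (φ-assemble a)
  ext-assemble a (b ∷ u) = trans (cong₂ _++_ (φ-assemble a) (ext-assemble b u))
                                 (assemble-++ (x a) (v a) (y a) (x b) (blocks b u) (y (lastLetter b u)))

  zeroFree-blocks : ∀ a u {B} → B ∈ blocks a u → ZeroFree B
  zeroFree-blocks a u B∈ with ∈-blocks⁻ a u B∈
  ... | inj₁ (c , B∈vc)           = zeroFree-v c B∈vc
  ... | inj₂ (c , d , _ , refl)   = zeroFree-++ (zeroFree-y c) (zeroFree-x d)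

  Infix-ext⁻ : ∀ u {r} → ZeroFree r → Infix _≡_ (zero ∷ r ++ [ zero ]) (ext φ u) →
               (∃ λ a → r ∈ v a) ⊎ (∃₂ λ a b → Infix _≡_ (a ∷ b ∷ []) u × r ≡ y a ++ x b)
  Infix-ext⁻ []      zr (here ())
  Infix-ext⁻ (a ∷ u) zr inf = ∈-blocks⁻ a u
    (Infix-assemble⁻ (x a) (blocks a u) (zeroFree-x a) (zeroFree-blocks a u) (zeroFree-y (lastLetter a u)) zr
      (subst (Infix _≡_ _) (ext-assemble a u) inf))


≢[]⇒0<length : ∀ {a} {A : Set a} {u : List A} → u ≢ [] → 0 < length u
≢[]⇒0<length {u = []}    u≢[] = ⊥-elim (u≢[] refl)
≢[]⇒0<length {u = _ ∷ _} _    = s≤s z≤n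

module _ {n} {φ : Morphism n} where

  iter-zero∷ : ∀ {s} → φ zero ≡ zero ∷ s → ∀ k → ∃ λ t → iter φ k [ zero ] ≡ zero ∷ t
  iter-zero∷ φ0 zero = [] , refl
  iter-zero∷ {s} φ0 (suc k) with t , eq ← iter-zero∷ φ0 k =
    s ++ ext φ t , trans (cong (ext φ) eq) (cong (_++ ext φ t) φ0)

  module _ (nonErasing : NonErasing φ) where
    open ≤-Reasoning

    length-ext : ∀ u → length u ≤ length (ext φ u)
    length-ext []      = z≤n
    length-ext (a ∷ u) = begin
      suc (length u)                   ≤⟨ +-mono-≤ (≢[]⇒0<length (nonErasing a)) (length-ext u) ⟩
      length (φ a) + length (ext φ u)  ≡⟨ length-++ (φ a) ⟨
      length (ext φ (a ∷ u))           ∎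

    module _ {s} (φ0 : φ zero ≡ zero ∷ s) (s≢[] : s ≢ []) where

      length-ext-zero∷ : ∀ u → length (zero ∷ u) < length (ext φ (zero ∷ u))
      length-ext-zero∷ u = begin-strict
        length (zero ∷ u)                   <⟨ s≤s (+-mono-≤ (≢[]⇒0<length s≢[]) (length-ext u)) ⟩
        suc (length s + length (ext φ u))   ≡⟨ cong suc (length-++ s) ⟨
        length (zero ∷ s ++ ext φ u)        ≡⟨ cong (λ p → length (p ++ ext φ u)) φ0 ⟨
        length (ext φ (zero ∷ u))           ∎

      iter-length : ∀ k → k < length (iter φ k [ zero ])
      iter-length zero    = s≤s z≤n
      iter-length (suc k) with t , eq ← iter-zero∷ φ0 k = begin-strict
        suc k                             ≤⟨ subst (λ u → k < length u) eq (iter-length k) ⟩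
        length (zero ∷ t)                 <⟨ length-ext-zero∷ t ⟩
        length (ext φ (zero ∷ t))         ≡⟨ cong (length ∘ ext φ) eq ⟨
        length (iter φ (suc k) [ zero ])  ∎


lemma5 : ∀ {n} (φ : Morphism n) (w : InfWord n)
           → GeneratedBy φ w
           → Primitive φ
           → (∀ a b → b ∈ φ a)
           → (x : Letter n → Word n) (v : Letter n → List (Word n)) (y : Letter n → Word n)
           → Decomposition φ x v y
           → ∀ i j → IsReturnAt w i j
           → (Σ (Letter n) λ a → Σ (Fin (length (v a))) λ k → slice w i j ≡ Fin.zero ∷ lookup (v a) k)
             ⊎ (Σ (Letter n) λ a → Σ (Letter n) λ b → Edge w a b × slice w i j ≡ Fin.zero ∷ (y a ++ x b))
lemma5 φ w (nonErasing , (s , φ0 , s≢[]) , prefix) _ _ x v y D i j return@(i<j , wi , _) =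
  Sum.map inner junction (Infix-ext⁻ D u (zeroFree-return w return) return∈φu)
  where
  u : Word _
  u = iter φ j [ zero ]

  r : Word _
  r = slice w (suc i) j

  return∈φu : Infix _≡_ (zero ∷ r ++ [ zero ]) (ext φ u)
  return∈φu = subst₂ (Infix _≡_) (slice-return w return) (prefix (suc j))
    (Infix-slice w z≤n (m≤n⇒m≤1+n (<⇒≤ i<j)) (<⇒≤ (iter-length nonErasing φ0 s≢[] (suc j))))

  slice≡ : slice w i j ≡ zero ∷ r
  slice≡ = trans (slice-∷ w i<j) (cong (_∷ r) wi)

  inner : (∃ λ a → r ∈ v a) →
          Σ (Letter _) λ a → Σ (Fin (length (v a))) λ k → slice w i j ≡ zero ∷ lookup (v a) k
  inner (a , r∈va) = a , index r∈va , trans slice≡ (cong (zero ∷_) (lookup-index r∈va))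

  junction : (∃₂ λ a b → Infix _≡_ (a ∷ b ∷ []) u × r ≡ y a ++ x b) →
             Σ (Letter _) λ a → Σ (Letter _) λ b → Edge w a b × slice w i j ≡ zero ∷ (y a ++ x b)
  junction (a , b , ab , r≡) = a , b , IsPrefix⇒Edge w (prefix j) ab , trans slice≡ (cong (zero ∷_) r≡)
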